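{- Let $L_5=\{ -3,-2,-1,0,1\}$ with its natural order. Define games over $L_5$: $\star=\{ -1\mid -3\}$, and for a game $G$: $M(G)=\{1\mid G\}$, $P(G)=\{G\mid -2\}$, $P_\star(G)=\{G\mid \star\}$; for $n\in\mathbb{N}$ let $P_n(G)=P(G)$ if $n$ is odd and $P_n(G)=P_\star(G)$ if $n$ is even. Define $G_0=0$ (the atomic game $[0]$) and $G_{n+1}=M(P_n(G_n))$. Then for all $n\in\mathbb{N}$, $G_n\leq G_{n+1}$.
   Context: Games over a poset $A$ (whose elements are called atoms) are defined inductively: for each $a\in A$, $[a]$ is a game (atomic game, often written simply $a$); and whenever $L$ and $R$ are non-empty sets of games, $\{L\mid R\}$ is a game, whose elements of $L$ (resp. $R$) are its left options $G^L$ (resp. right options $G^R$); $\{G_1,\dots\mid H_1,\dots\}$ denotes the game with those left and right options. Relations $\leq$ and $\lhd$ are defined by mutual recursion: $G\leq H$ iff (1) every left option $G^L$ satisfies $G^L\lhd H$, (2) every right option $H^R$ satisfies $G\lhd H^R$, and (3) if $G$ or $H$ is atomic then $G\lhd H$. And $G\lhd H$ iff at least one of: (1) some right option $G^R$ satisfies $G^R\leq H$, (2) some left option $H^L$ satisfies $G\leq H^L$, (3) $G=[a]$, $H=[b]$ are atomic with $a\leq b$. -}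

module Defs where

open import Level using (Level; suc; _⊔_)
open import Data.Unit using (⊤; tt)
open import Data.Empty using (⊥)
open import Data.Sum using (_⊎_)
open import Data.Nat as ℕ using (ℕ; zero)
open import Data.Integer using (ℤ; +_; -[1+_]) renaming (_≤_ to _≤ℤ_)
open import Data.Bool using (Bool; true; false; not)

-- A compound game {L | R} has a NON-EMPTY family of left options and a
-- NON-EMPTY family of right options; families are indexed by arbitrary
-- types, non-emptiness witnessed by a chosen index.
module GameTheory (A : Set) (_≤A_ : A → A → Set) where

  data Game : Set₁ where
    atom : A → Game
    node : (I : Set) → I → (I → Game) → (J : Set) → J → (J → Game) → Game

  LIdx : Game → Set
  LIdx (atom _) = ⊥
  LIdx (node I _ _ _ _ _) = I

  RIdx : Game → Set
  RIdx (atom _) = ⊥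
  RIdx (node _ _ _ J _ _) = J

  leftOpt : (G : Game) → LIdx G → Game
  leftOpt (node _ _ f _ _ _) i = f i

  rightOpt : (G : Game) → RIdx G → Game
  rightOpt (node _ _ _ _ _ g) j = g j

  IsAtomic : Game → Set
  IsAtomic (atom _) = ⊤
  IsAtomic (node _ _ _ _ _ _) = ⊥

  ⟨_∣_⟩ : Game → Game → Game
  ⟨ G ∣ H ⟩ = node ⊤ tt (λ _ → G) ⊤ tt (λ _ → H)

  data _≤G_ : Game → Game → Set₁
  data _◁_ : Game → Game → Set₁

  data _≤G_ where
    le : {G H : Game}
       → ((l : LIdx G) → leftOpt G l ◁ H)
       → ((r : RIdx H) → G ◁ rightOpt H r)
       → (IsAtomic G ⊎ IsAtomic H → G ◁ H)
       → G ≤G H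

  data _◁_ where
    lf-right : {G H : Game} (r : RIdx G) → rightOpt G r ≤G H → G ◁ H
    lf-left  : {G H : Game} (l : LIdx H) → G ≤G leftOpt H l → G ◁ H
    lf-atom  : {a b : A} → a ≤A b → atom a ◁ atom b

data L5 : Set where
  −3 −2 −1 𝟘 𝟙 : L5

toℤ : L5 → ℤ
toℤ −3 = -[1+ 2 ]
toℤ −2 = -[1+ 1 ]
toℤ −1 = -[1+ 0 ]
toℤ 𝟘  = + 0
toℤ 𝟙  = + 1

_≤L5_ : L5 → L5 → Set
a ≤L5 b = toℤ a ≤ℤ toℤ b

open GameTheory L5 _≤L5_ public

⋆ : Game
⋆ = ⟨ atom −1 ∣ atom −3 ⟩

M : Game → Game
M G = ⟨ atom 𝟙 ∣ G ⟩

P : Game → Game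
P G = ⟨ G ∣ atom −2 ⟩

P⋆ : Game → Game
P⋆ G = ⟨ G ∣ ⋆ ⟩

isOdd : ℕ → Bool
isOdd zero      = false
isOdd (ℕ.suc n) = not (isOdd n)

Pn : ℕ → Game → Game
Pn n with isOdd n
... | true  = P
... | false = P⋆

Gseq : ℕ → Game
Gseq zero      = atom 𝟘
Gseq (ℕ.suc n) = M (Pn n (Gseq n))

{-# OPTIONS --safe #-}
module Submission where

open import Defs
open import Data.Nat using (ℕ; zero; suc; z≤n)
open import Data.Unit using (tt)
open import Data.Sum using (inj₁; inj₂)
open import Data.Bool using (true; false)
open import Data.Integer using (+≤+)
open import Data.Integer.Properties using (≤-refl)

-- No induction is needed. Gₙ and Gₙ₊₁ share the left option 1 (for n ≥ 1), and
-- the right option Pₙ(Gₙ) of Gₙ₊₁ has Gₙ itself as a left option, so Gₙ ◁ Pₙ(Gₙ)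
-- by reflexivity. For the atomic G₀ = 0 one also needs 0 ◁ G₁, which holds as 0 ≤ 1.

≤G-refl : ∀ G → G ≤G G
≤G-refl (atom a) = le (λ ()) (λ ()) (λ _ → lf-atom ≤-refl)
≤G-refl (node _ _ f _ _ g) =
  le (λ l → lf-left l (≤G-refl (f l))) (λ r → lf-right r (≤G-refl (g r)))
     (λ { (inj₁ ()) ; (inj₂ ()) })

◁-⟨∣⟩ : ∀ {G H} K → G ≤G H → G ◁ ⟨ H ∣ K ⟩
◁-⟨∣⟩ _ G≤H = lf-left tt G≤H

⟨∣⟩-mono : ∀ {G G′ H H′} → G ≤G G′ → ⟨ G ∣ H ⟩ ◁ H′ → ⟨ G ∣ H ⟩ ≤G ⟨ G′ ∣ H′ ⟩
⟨∣⟩-mono G≤G′ ◁H′ =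
  le (λ _ → ◁-⟨∣⟩ _ G≤G′) (λ _ → ◁H′) (λ { (inj₁ ()) ; (inj₂ ()) })

◁-Pn : ∀ m G → G ◁ Pn m G
◁-Pn m G with isOdd m
... | true  = ◁-⟨∣⟩ (atom −2) (≤G-refl G)
... | false = ◁-⟨∣⟩ ⋆ (≤G-refl G)

atom-≤-⟨∣⟩ : ∀ {a G H} → atom a ≤G G → atom a ◁ H → atom a ≤G ⟨ G ∣ H ⟩
atom-≤-⟨∣⟩ a≤G a◁H = le (λ ()) (λ _ → a◁H) (λ _ → ◁-⟨∣⟩ _ a≤G)

𝟘≤𝟙 : atom 𝟘 ≤G atom 𝟙
𝟘≤𝟙 = le (λ ()) (λ ()) (λ _ → lf-atom (+≤+ z≤n))

lemma2 : (n : ℕ) → Gseq n ≤G Gseq (suc n)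
lemma2 zero    = atom-≤-⟨∣⟩ 𝟘≤𝟙 (◁-Pn 0 (atom 𝟘))
lemma2 (suc n) = ⟨∣⟩-mono (≤G-refl (atom 𝟙)) (◁-Pn (suc n) (Gseq (suc n)))
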